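{- Let $\langle S,A\rangle$ be an exact cover instance and let $\langle P,E,\tau\rangle$, $P=\langle\Omega,F,\pi\rangle$, be the persuasion instance constructed from it as described in the context. Then every observation $R\subseteq F$ such that $\bigcap R$ contains at least one world $Z_\ell$ satisfies $P(E\mid R)<\tau$.
   Context: An exact cover instance is a pair $\langle S,A\rangle$ with $S=\{s_1,\dots,s_n\}$ finite and $A=\{A_1,\dots,A_k\}$ a set of non-empty, pairwise different subsets of $S$ with $A_1\cup\dots\cup A_k=S$. Let $m=\sum_{i=1}^k|A_i|$. The constructed instance is: $\Omega=\{W_0\}\cup\{X_0\}\cup Y\cup Z$ where $Y=\{Y_{i,\ell}: 1\le i\le k,\ 1\le\ell\le n,\ s_\ell\in A_i\}$ ($m$ worlds) and $Z=\{Z_\ell:1\le\ell\le n\}$ ($n$ worlds); $F=\{F_1,\dots,F_k\}$ with $F_i=\Omega\setminus\{Y_{i,\ell}: s_\ell\in A_i\}\setminus\{Z_\ell: s_\ell\in A_i\}$; $\pi(W_0)=\pi(X_0)=x$, $\pi(Y_{i,\ell})=y$ for all $Y$-worlds, $\pi(Z_\ell)=z$ for all $Z$-worlds, where $x=1/3$, $y=\frac{1-2x}{m(1+2n)}$, $z=2my$; goal $E=\{W_0\}\cup Y$; threshold $\tau=\frac{x+(m-n)y}{2x+(m-n)y}$. For $R\subseteq F$ (an observation), $P(E\mid R)=\pi^*(E\cap\bigcap R)/\pi^*(\bigcap R)$, where $\pi^*(T)=\sum_{\omega\in T}\pi(\omega)$ and $\bigcap\emptyset=\Omega$. -}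

module Defs where

open import Data.Nat using (ℕ; suc)
open import Data.Integer using (+_)
open import Data.Rational using (ℚ; 0ℚ; 1ℚ; _+_; _*_; _-_; _÷_; _/_; _≟_; ≢-nonZero)
open import Data.Bool using (Bool; true; false; not; _∧_; _∨_; if_then_else_)
open import Data.Fin using (Fin)
import Data.Fin as F
open import Data.Fin.Subset using (Subset; _∈_; Nonempty; ∣_∣)
open import Data.Fin.Subset.Properties using (_∈?_)
open import Data.List using (List; []; _∷_; _++_; filter; map; sum; concatMap; allFin; foldr)
open import Data.Product using (∃)
open import Relation.Nullary using (yes; no; ⌊_⌋)
open import Relation.Binary.PropositionalEquality using (_≡_)

record IsExactCoverInstance (n k : ℕ) (A : Fin k → Subset n) : Set where
  field
    nonempty  : ∀ i → Nonempty (A i)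
    distinct  : ∀ i j → A i ≡ A j → i ≡ j
    covers    : ∀ ℓ → ∃ λ i → ℓ ∈ A i

-- Division on ℚ, total: q ÷ 0 := 0 (only used where the divisor is nonzero
-- in the situations the theorem speaks about).
_÷'_ : ℚ → ℚ → ℚ
p ÷' q with q ≟ 0ℚ
... | yes _  = 0ℚ
... | no q≢0 = _÷_ p q {{≢-nonZero q≢0}}

fromℕ : ℕ → ℚ
fromℕ a = + a / 1

-- Candidate worlds.  The world Y i ℓ is a genuine world only if s_ℓ ∈ A_i;
-- the set Ω is the list 'Ω' below.
data World (n k : ℕ) : Set where
  W0 X0 : World n k
  Y     : Fin k → Fin n → World n k
  Z     : Fin n → World n k

module Construction (n k : ℕ) (A : Fin k → Subset n) where

  inA : Fin k → Fin n → Bool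
  inA i ℓ = ⌊ ℓ ∈? A i ⌋

  Ω : List (World n k)
  Ω = W0 ∷ X0 ∷
      (concatMap (λ i → map (Y i) (filter (λ ℓ → ℓ ∈? A i) (allFin n))) (allFin k)
       ++ map Z (allFin n))

  m : ℕ
  m = foldr (λ i acc → ∣ A i ∣ Data.Nat.+ acc) 0 (allFin k)
    where import Data.Nat

  x y z : ℚ
  x = + 1 / 3
  y = (1ℚ - (fromℕ 2 * x)) ÷' (fromℕ m * (1ℚ + fromℕ 2 * fromℕ n))
  z = fromℕ 2 * fromℕ m * y

  π : World n k → ℚ
  π W0      = x
  π X0      = x
  π (Y _ _) = y
  π (Z _)   = z

  inF : Fin k → World n k → Bool
  inF i (Y j ℓ) = not (⌊ i F.≟ j ⌋ ∧ inA i ℓ)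
  inF i (Z ℓ)   = not (inA i ℓ)
  inF i W0      = true
  inF i X0      = true

  inE : World n k → Bool
  inE W0      = true
  inE X0      = false
  inE (Y _ _) = true
  inE (Z _)   = false

  -- observation R ⊆ F, encoded as a subset of the indices of F;
  -- membership in ⋂ R (with ⋂ ∅ = Ω)
  inCap : Subset k → World n k → Bool
  inCap R ω = foldr (λ i acc → (not ⌊ i ∈? R ⌋ ∨ inF i ω) ∧ acc) true (allFin k)

  π* : (World n k → Bool) → ℚ
  π* P = foldr (λ ω acc → (if P ω then π ω else 0ℚ) + acc) 0ℚ Ω

  condProb : Subset k → ℚ
  condProb R = π* (λ ω → inE ω ∧ inCap R ω) ÷' π* (inCap R)

  τ : ℚ
  τ = (x + (fromℕ m - fromℕ n) * y) ÷' (fromℕ 2 * x + (fromℕ m - fromℕ n) * y)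

{-# OPTIONS --safe #-}

-- The worlds W0 and X0 lie in every F_i, hence in ⋂R, each with weight x.  E ∩ ⋂R consists of
-- W0 and the Y-worlds of ⋂R, whose total weight is at most m·y, whereas ⋂R also contains X0 and
-- some Z_ℓ of weight z = 2·m·y.  So 2·π*(E ∩ ⋂R) < π*(⋂R), i.e. P(E | R) < ½.  On the other
-- hand every s_ℓ lies in some A_i, so n ≤ m, hence (m − n)·y ≥ 0 and τ ≥ ½.

module Submission where

open import Defs
open import Data.Nat as ℕ using (ℕ; suc; z≤n; s≤s)
import Data.Nat.Properties as ℕ
open import Data.Rational
  using (ℚ; mkℚ; toℚᵘ; 0ℚ; 1ℚ; ½; _+_; _*_; _-_; 1/_; _≤_; _<_; ≢-nonZero; positive; nonNegative)
open import Data.Rational.Properties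
open import Data.Rational.Solver using (module +-*-Solver)
import Data.Rational.Unnormalised as ℚᵘ
import Data.Rational.Unnormalised.Properties as ℚᵘ
open import Data.Nat.Coprimality using (1-coprimeTo)
import Data.Nat.Coprimality as Coprime
import Data.Integer as ℤ
import Data.Integer.Properties as ℤ
open import Data.Bool using (Bool; true; false; not; _∧_; _∨_; if_then_else_)
open import Data.Bool.Properties using (∨-zeroʳ)
open import Data.Fin using (Fin; zero; suc)
open import Data.Fin.Properties using (toℕ<n)
open import Data.Fin.Subset using (Subset; _∈_; _∪_; ⋃; ⊤; _⊆_; ∣_∣; inside; outside)
open import Data.Fin.Subset.Properties using (_∈?_; x∈p∪q⁺; ∣⊥∣≡0; ∣⊤∣≡n; p⊆q⇒∣p∣≤∣q∣)
open import Data.List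
  using (List; []; _∷_; _++_; map; foldr; filter; length; tabulate; concatMap; allFin)
open import Data.Nat.ListAction using (sum)
open import Data.Vec using ([]; _∷_)
open import Data.List.Properties using (foldr-map; length-++; length-map)
open import Data.List.Relation.Unary.All using (All; []; _∷_)
import Data.List.Relation.Unary.All as All
import Data.List.Relation.Unary.All.Properties as All
open import Data.List.Relation.Unary.Any using (Any; here; there)
import Data.List.Membership.Propositional as List
open import Data.List.Membership.Propositional.Properties using (∈-allFin; ∈-map⁺)
import Data.List.Relation.Unary.Any.Properties as Any
open import Data.Product using (∃; _,_)
open import Data.Sum using (inj₁; inj₂)
open import Function using (_∘_; id)
open import Relation.Nullary using (Dec; does; yes; no; ⌊_⌋; contradiction)
open import Relation.Binary.PropositionalEquality
  using (_≡_; _≢_; ≢-sym; refl; sym; trans; cong; cong₂; subst; module ≡-Reasoning)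

fromℕ≡mkℚ : ∀ a → fromℕ a ≡ mkℚ (ℤ.+ a) 0 (Coprime.sym (1-coprimeTo a))
fromℕ≡mkℚ a = normalize-coprime (Coprime.sym (1-coprimeTo a))

fromℕ-+ : ∀ a b → fromℕ (a ℕ.+ b) ≡ fromℕ a + fromℕ b
fromℕ-+ a b = toℚᵘ-injective (ℚᵘ.≃-trans toℚᵘ-fromℕ-+ (ℚᵘ.≃-sym (toℚᵘ-homo-+ (fromℕ a) (fromℕ b))))
  where
  open import Data.Integer using (+_)
  toℚᵘ-fromℕ-+ : toℚᵘ (fromℕ (a ℕ.+ b)) ℚᵘ.≃ toℚᵘ (fromℕ a) ℚᵘ.+ toℚᵘ (fromℕ b)
  toℚᵘ-fromℕ-+ rewrite fromℕ≡mkℚ (a ℕ.+ b) | fromℕ≡mkℚ a | fromℕ≡mkℚ b =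
    ℚᵘ.*≡* (begin
      + (a ℕ.+ b) ℤ.* + 1                    ≡⟨ ℤ.*-identityʳ _ ⟩
      + (a ℕ.+ b)                            ≡⟨ ℤ.pos-+ a b ⟩
      + a ℤ.+ + b                            ≡⟨ cong₂ ℤ._+_ (ℤ.*-identityʳ (+ a)) (ℤ.*-identityʳ (+ b)) ⟨
      + a ℤ.* + 1 ℤ.+ + b ℤ.* + 1            ≡⟨ ℤ.*-identityʳ _ ⟨
      (+ a ℤ.* + 1 ℤ.+ + b ℤ.* + 1) ℤ.* + 1  ∎)
    where open ≡-Reasoning

fromℕ-nonNeg : ∀ a → 0ℚ ≤ fromℕ a
fromℕ-nonNeg a rewrite fromℕ≡mkℚ a = nonNegative⁻¹ _

fromℕ-pos : ∀ {a} → 0 ℕ.< a → 0ℚ < fromℕ a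
fromℕ-pos {suc a} _ rewrite fromℕ≡mkℚ (suc a) = positive⁻¹ _

fromℕ-∸ : ∀ {m n} → n ℕ.≤ m → fromℕ (m ℕ.∸ n) ≡ fromℕ m - fromℕ n
fromℕ-∸ {m} {n} n≤m = begin
  fromℕ (m ℕ.∸ n)                        ≡⟨ solve 2 (λ a b → b := (a :+ b) :- a) refl (fromℕ n) _ ⟩
  (fromℕ n + fromℕ (m ℕ.∸ n)) - fromℕ n  ≡⟨ cong (_- fromℕ n) (fromℕ-+ n (m ℕ.∸ n)) ⟨
  fromℕ (n ℕ.+ (m ℕ.∸ n)) - fromℕ n      ≡⟨ cong (λ a → fromℕ a - fromℕ n) (ℕ.m+[n∸m]≡n n≤m) ⟩
  fromℕ m - fromℕ n                      ∎
  where
  open ≡-Reasoning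
  open +-*-Solver

*-nonNeg : ∀ {p q} → 0ℚ ≤ p → 0ℚ ≤ q → 0ℚ ≤ p * q
*-nonNeg {p} {q} 0≤p 0≤q =
  nonNegative⁻¹ _ {{nonNeg*nonNeg⇒nonNeg p {{nonNegative 0≤p}} q {{nonNegative 0≤q}}}}

*-pos : ∀ {p q} → 0ℚ < p → 0ℚ < q → 0ℚ < p * q
*-pos {p} {q} 0<p 0<q = positive⁻¹ _ {{pos*pos⇒pos p {{positive 0<p}} q {{positive 0<q}}}}

÷'-*-cancel : ∀ p {q} → q ≢ 0ℚ → (p ÷' q) * q ≡ p
÷'-*-cancel p {q} q≢0 with q ≟ 0ℚ
... | yes q≡0 = contradiction q≡0 q≢0
... | no _ = begin
  p * 1/ q * q    ≡⟨ *-assoc p (1/ q) q ⟩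
  p * (1/ q * q)  ≡⟨ cong (p *_) (*-inverseˡ q) ⟩
  p * 1ℚ          ≡⟨ *-identityʳ p ⟩
  p               ∎
  where
  open ≡-Reasoning
  instance _ = ≢-nonZero q≢0

-- Includes q = 0, where _÷'_ returns 0.
÷'-nonNeg : ∀ {p q} → 0ℚ ≤ p → 0ℚ ≤ q → 0ℚ ≤ p ÷' q
÷'-nonNeg {p} {q} 0≤p 0≤q = nonNeg (q ≟ 0ℚ)
  where
  open ≤-Reasoning
  nonNeg : Dec (q ≡ 0ℚ) → 0ℚ ≤ p ÷' q
  nonNeg (yes q≡0) = subst (λ r → 0ℚ ≤ p ÷' r) (sym q≡0) ≤-refl
  nonNeg (no q≢0)  = *-cancelʳ-≤-pos q (begin
    0ℚ * q      ≡⟨ *-zeroˡ q ⟩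
    0ℚ          ≤⟨ 0≤p ⟩
    p           ≡⟨ ÷'-*-cancel p q≢0 ⟨
    p ÷' q * q  ∎)
    where instance _ = nonNeg∧nonZero⇒pos q {{nonNegative 0≤q}} {{≢-nonZero q≢0}}

÷'-pos : ∀ {p q} → 0ℚ < p → 0ℚ < q → 0ℚ < p ÷' q
÷'-pos {p} {q} 0<p 0<q = *-cancelʳ-<-nonNeg q (begin-strict
  0ℚ * q      ≡⟨ *-zeroˡ q ⟩
  0ℚ          <⟨ 0<p ⟩
  p           ≡⟨ ÷'-*-cancel p (≢-sym (<⇒≢ 0<q)) ⟨
  p ÷' q * q  ∎)
  where
  open ≤-Reasoning
  instance _ = pos⇒nonNeg q {{positive 0<q}}

½*[p+p]≡p : ∀ p → ½ * (p + p) ≡ p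
½*[p+p]≡p = solve 1 (λ p → con ½ :* (p :+ p) := p) refl
  where open +-*-Solver

÷'-<-½ : ∀ {a b} → 0ℚ < b → a + a < b → a ÷' b < ½
÷'-<-½ {a} {b} 0<b a+a<b = *-cancelʳ-<-nonNeg b (begin-strict
  a ÷' b * b  ≡⟨ ÷'-*-cancel a (≢-sym (<⇒≢ 0<b)) ⟩
  a           ≡⟨ ½*[p+p]≡p a ⟨
  ½ * (a + a) <⟨ *-monoʳ-<-pos ½ a+a<b ⟩
  ½ * b       ∎)
  where
  open ≤-Reasoning
  instance _ = pos⇒nonNeg b {{positive 0<b}}

½-≤-÷' : ∀ {c d} → 0ℚ < d → d ≤ c + c → ½ ≤ c ÷' d
½-≤-÷' {c} {d} 0<d d≤c+c = *-cancelʳ-≤-pos d (begin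
  ½ * d       ≤⟨ *-monoˡ-≤-nonNeg ½ d≤c+c ⟩
  ½ * (c + c) ≡⟨ ½*[p+p]≡p c ⟩
  c           ≡⟨ ÷'-*-cancel c (≢-sym (<⇒≢ 0<d)) ⟨
  c ÷' d * d  ∎)
  where
  open ≤-Reasoning
  instance _ = positive 0<d

∣p∪q∣≤∣p∣+∣q∣ : ∀ {n} (p q : Subset n) → ∣ p ∪ q ∣ ℕ.≤ ∣ p ∣ ℕ.+ ∣ q ∣
∣p∪q∣≤∣p∣+∣q∣ []            []            = z≤n
∣p∪q∣≤∣p∣+∣q∣ (outside ∷ p) (outside ∷ q) = ∣p∪q∣≤∣p∣+∣q∣ p q
∣p∪q∣≤∣p∣+∣q∣ (outside ∷ p) (inside  ∷ q) =
  ℕ.≤-trans (s≤s (∣p∪q∣≤∣p∣+∣q∣ p q)) (ℕ.≤-reflexive (sym (ℕ.+-suc ∣ p ∣ ∣ q ∣)))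
∣p∪q∣≤∣p∣+∣q∣ (inside  ∷ p) (outside ∷ q) = s≤s (∣p∪q∣≤∣p∣+∣q∣ p q)
∣p∪q∣≤∣p∣+∣q∣ (inside  ∷ p) (inside  ∷ q) =
  s≤s (ℕ.≤-trans (∣p∪q∣≤∣p∣+∣q∣ p q) (ℕ.+-monoʳ-≤ ∣ p ∣ (ℕ.n≤1+n ∣ q ∣)))

∣⋃ps∣≤sum∣ps∣ : ∀ {n} (ps : List (Subset n)) → ∣ ⋃ ps ∣ ℕ.≤ sum (map ∣_∣ ps)
∣⋃ps∣≤sum∣ps∣ {n} []       = ℕ.≤-reflexive (∣⊥∣≡0 n)
∣⋃ps∣≤sum∣ps∣     (p ∷ ps) =
  ℕ.≤-trans (∣p∪q∣≤∣p∣+∣q∣ p (⋃ ps)) (ℕ.+-monoʳ-≤ ∣ p ∣ (∣⋃ps∣≤sum∣ps∣ ps))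

Any-∈⇒∈⋃ : ∀ {n} {x : Fin n} {ps} → Any (x ∈_) ps → x ∈ ⋃ ps
Any-∈⇒∈⋃ (here x∈p)   = x∈p∪q⁺ (inj₁ x∈p)
Any-∈⇒∈⋃ (there x∈ps) = x∈p∪q⁺ (inj₂ (Any-∈⇒∈⋃ x∈ps))

length-filter-∈-tabulate : ∀ {m n} (f : Fin m → Fin n) (p : Subset n) (q : Subset m) →
  (∀ i → does (f i ∈? p) ≡ does (i ∈? q)) → length (filter (_∈? p) (tabulate f)) ≡ ∣ q ∣
length-filter-∈-tabulate f p []      _    = refl
length-filter-∈-tabulate f p (s ∷ q) f⇔q with does (f zero ∈? p) | f⇔q zero
length-filter-∈-tabulate f p (inside  ∷ q) f⇔q | true  | _ =
  cong suc (length-filter-∈-tabulate (f ∘ suc) p q (f⇔q ∘ suc))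
length-filter-∈-tabulate f p (outside ∷ q) f⇔q | false | _ =
  length-filter-∈-tabulate (f ∘ suc) p q (f⇔q ∘ suc)

length-filter-∈-allFin : ∀ {n} (p : Subset n) → length (filter (_∈? p) (allFin n)) ≡ ∣ p ∣
length-filter-∈-allFin p = length-filter-∈-tabulate id p p (λ _ → refl)

module _ {W : Set} (w : W → ℚ) where

  weightIf : (W → Bool) → W → ℚ
  weightIf P ω = if P ω then w ω else 0ℚ

  mass : (W → Bool) → List W → ℚ
  mass P = foldr (λ ω acc → weightIf P ω + acc) 0ℚ

  mass-++ : ∀ P xs ys → mass P (xs ++ ys) ≡ mass P xs + mass P ys
  mass-++ P []       ys = sym (+-identityˡ (mass P ys))
  mass-++ P (ω ∷ xs) ys = trans (cong (weightIf P ω +_) (mass-++ P xs ys))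
                                (sym (+-assoc (weightIf P ω) (mass P xs) (mass P ys)))

  mass-cong : ∀ {P Q xs} → All (λ ω → P ω ≡ Q ω) xs → mass P xs ≡ mass Q xs
  mass-cong []                            = refl
  mass-cong {xs = ω ∷ _} (Pω≡Qω ∷ rest) =
    cong₂ _+_ (cong (λ b → if b then w ω else 0ℚ) Pω≡Qω) (mass-cong rest)

  mass-false : ∀ {P xs} → All (λ ω → P ω ≡ false) xs → mass P xs ≡ 0ℚ
  mass-false []                            = refl
  mass-false {xs = ω ∷ _} (Pω≡false ∷ rest) =
    cong₂ _+_ (cong (λ b → if b then w ω else 0ℚ) Pω≡false) (mass-false rest)

  module _ (w-nonNeg : ∀ ω → 0ℚ ≤ w ω) where

    weightIf-nonNeg : ∀ P ω → 0ℚ ≤ weightIf P ω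
    weightIf-nonNeg P ω with P ω
    ... | true  = w-nonNeg ω
    ... | false = ≤-refl

    weightIf-≤ : ∀ P ω → weightIf P ω ≤ w ω
    weightIf-≤ P ω with P ω
    ... | true  = ≤-refl
    ... | false = w-nonNeg ω

    mass-nonNeg : ∀ P xs → 0ℚ ≤ mass P xs
    mass-nonNeg P []       = ≤-refl
    mass-nonNeg P (ω ∷ xs) = +-mono-≤ (weightIf-nonNeg P ω) (mass-nonNeg P xs)

    mass-≤-length* : ∀ P {c xs} → All (λ ω → w ω ≤ c) xs → mass P xs ≤ fromℕ (length xs) * c
    mass-≤-length* P {c} []                  = ≤-reflexive (sym (*-zeroˡ c))
    mass-≤-length* P {c} {ω ∷ xs} (ω≤c ∷ rest) = begin
      weightIf P ω + mass P xs
        ≤⟨ +-mono-≤ (≤-trans (weightIf-≤ P ω) ω≤c) (mass-≤-length* P rest) ⟩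
      c + fromℕ (length xs) * c          ≡⟨ cong (_+ fromℕ (length xs) * c) (*-identityˡ c) ⟨
      1ℚ * c + fromℕ (length xs) * c     ≡⟨ *-distribʳ-+ c 1ℚ (fromℕ (length xs)) ⟨
      (1ℚ + fromℕ (length xs)) * c       ≡⟨ cong (_* c) (fromℕ-+ 1 (length xs)) ⟨
      fromℕ (suc (length xs)) * c        ∎
      where open ≤-Reasoning

    member-≤-mass : ∀ P {ω xs} → ω List.∈ xs → P ω ≡ true → w ω ≤ mass P xs
    member-≤-mass P {ω} {_ ∷ xs} (here refl) Pω≡true = begin
      w ω                       ≡⟨ +-identityʳ (w ω) ⟨
      w ω + 0ℚ                  ≡⟨ cong (λ b → (if b then w ω else 0ℚ) + 0ℚ) Pω≡true ⟨
      weightIf P ω + 0ℚ         ≤⟨ +-monoʳ-≤ (weightIf P ω) (mass-nonNeg P xs) ⟩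
      weightIf P ω + mass P xs  ∎
      where open ≤-Reasoning
    member-≤-mass P {ω} {ω′ ∷ xs} (there ω∈xs) Pω≡true = begin
      w ω                        ≤⟨ member-≤-mass P ω∈xs Pω≡true ⟩
      mass P xs                  ≡⟨ +-identityˡ (mass P xs) ⟨
      0ℚ + mass P xs             ≤⟨ +-monoˡ-≤ (mass P xs) (weightIf-nonNeg P ω′) ⟩
      weightIf P ω′ + mass P xs  ∎
      where open ≤-Reasoning

module _ {n k : ℕ} (A : Fin k → Subset n) where
  open Construction n k A

  covering⇒n≤m : IsExactCoverInstance n k A → n ℕ.≤ m
  covering⇒n≤m cover = begin
    n                                  ≡⟨ ∣⊤∣≡n n ⟨
    ∣ ⊤ {n} ∣                          ≤⟨ p⊆q⇒∣p∣≤∣q∣ ⊤⊆⋃A ⟩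
    ∣ ⋃ (map A (allFin k)) ∣           ≤⟨ ∣⋃ps∣≤sum∣ps∣ (map A (allFin k)) ⟩
    sum (map ∣_∣ (map A (allFin k)))   ≡⟨ foldr-map ℕ._+_ ∣_∣ 0 (map A (allFin k)) ⟩
    foldr (λ p acc → ∣ p ∣ ℕ.+ acc) 0 (map A (allFin k)) ≡⟨ foldr-map _ A 0 (allFin k) ⟩
    m                                  ∎
    where
    open ℕ.≤-Reasoning
    ⊤⊆⋃A : ⊤ ⊆ ⋃ (map A (allFin k))
    ⊤⊆⋃A {ℓ} _ with IsExactCoverInstance.covers cover ℓ
    ... | i , ℓ∈Ai = Any-∈⇒∈⋃ (Any.map⁺ (Any.tabulate⁺ i ℓ∈Ai))

  -- Ω is definitionally W0 ∷ X0 ∷ Ys ++ Zs.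
  Yrow : Fin k → List (World n k)
  Yrow i = map (Y i) (filter (_∈? A i) (allFin n))

  Ys Zs : List (World n k)
  Ys = concatMap Yrow (allFin k)
  Zs = map Z (allFin n)

  all-Ys : ∀ {P : World n k → Set} → (∀ i ℓ → P (Y i ℓ)) → All P Ys
  all-Ys P-Y =
    All.concat⁺ (All.map⁺ (All.universal (λ i → All.map⁺ (All.universal (P-Y i) _)) (allFin k)))

  all-Zs : ∀ {P : World n k → Set} → (∀ ℓ → P (Z ℓ)) → All P Zs
  all-Zs P-Z = All.map⁺ (All.universal P-Z (allFin n))

  length-Ys : length Ys ≡ m
  length-Ys = go (allFin k)
    where
    go : ∀ is → length (concatMap Yrow is) ≡ foldr (λ i acc → ∣ A i ∣ ℕ.+ acc) 0 is
    go []       = refl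
    go (i ∷ is) = trans (length-++ (Yrow i))
      (cong₂ ℕ._+_ (trans (length-map (Y i) (filter (_∈? A i) (allFin n)))
                          (length-filter-∈-allFin (A i)))
                   (go is))

  ∈-all-F⇒∈⋂ : ∀ R {ω} → (∀ i → inF i ω ≡ true) → inCap R ω ≡ true
  ∈-all-F⇒∈⋂ R {ω} ω∈F = go (allFin k)
    where
    go : ∀ is → foldr (λ i acc → (not ⌊ i ∈? R ⌋ ∨ inF i ω) ∧ acc) true is ≡ true
    go []       = refl
    go (i ∷ is) rewrite ω∈F i | ∨-zeroʳ (not ⌊ i ∈? R ⌋) = go is

  0<1+2n : 0ℚ < 1ℚ + fromℕ 2 * fromℕ n
  0<1+2n = +-mono-<-≤ (positive⁻¹ 1ℚ) (*-nonNeg (nonNegative⁻¹ (fromℕ 2)) (fromℕ-nonNeg n))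

  y-nonNeg : 0ℚ ≤ y
  y-nonNeg = ÷'-nonNeg (nonNegative⁻¹ _) (*-nonNeg (fromℕ-nonNeg m) (<⇒≤ 0<1+2n))

  y-pos : 0 ℕ.< m → 0ℚ < y
  y-pos 0<m = ÷'-pos (positive⁻¹ _) (*-pos (fromℕ-pos 0<m) 0<1+2n)

  π-nonNeg : ∀ ω → 0ℚ ≤ π ω
  π-nonNeg W0      = nonNegative⁻¹ x
  π-nonNeg X0      = nonNegative⁻¹ x
  π-nonNeg (Y _ _) = y-nonNeg
  π-nonNeg (Z _)   = *-nonNeg (*-nonNeg (nonNegative⁻¹ (fromℕ 2)) (fromℕ-nonNeg m)) y-nonNeg

  ½-≤-τ : n ℕ.≤ m → ½ ≤ τ
  ½-≤-τ n≤m = ½-≤-÷' (+-mono-<-≤ (positive⁻¹ (fromℕ 2 * x)) 0≤M) (begin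
    fromℕ 2 * x + M
      ≡⟨ +-identityʳ _ ⟨
    (fromℕ 2 * x + M) + 0ℚ
      ≤⟨ +-monoʳ-≤ (fromℕ 2 * x + M) 0≤M ⟩
    (fromℕ 2 * x + M) + M
      ≡⟨ solve 2 (λ x M → (con (fromℕ 2) :* x :+ M) :+ M := (x :+ M) :+ (x :+ M)) refl x M ⟩
    (x + M) + (x + M) ∎)
    where
    open ≤-Reasoning
    open +-*-Solver
    M : ℚ
    M = (fromℕ m - fromℕ n) * y
    0≤M : 0ℚ ≤ M
    0≤M = *-nonNeg (subst (0ℚ ≤_) (fromℕ-∸ n≤m) (fromℕ-nonNeg (m ℕ.∸ n))) y-nonNeg

  module _ (R : Subset k) where

    massY massZ : ℚ
    massY = mass π (inCap R) Ys
    massZ = mass π (inCap R) Zs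

    W0∈⋂R : inCap R W0 ≡ true
    W0∈⋂R = ∈-all-F⇒∈⋂ R {W0} (λ _ → refl)

    X0∈⋂R : inCap R X0 ≡ true
    X0∈⋂R = ∈-all-F⇒∈⋂ R {X0} (λ _ → refl)

    numerator : π* (λ ω → inE ω ∧ inCap R ω) ≡ x + massY
    numerator = begin
      π* E∩⋂R
        ≡⟨ cong (λ b → (if b then x else 0ℚ) + (0ℚ + mass π E∩⋂R (Ys ++ Zs))) W0∈⋂R ⟩
      x + (0ℚ + mass π E∩⋂R (Ys ++ Zs))
        ≡⟨ cong (x +_) (trans (+-identityˡ _) (mass-++ π E∩⋂R Ys Zs)) ⟩
      x + (mass π E∩⋂R Ys + mass π E∩⋂R Zs)
        ≡⟨ cong₂ (λ p q → x + (p + q))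
             (mass-cong π {P = E∩⋂R} {Q = inCap R} (all-Ys (λ _ _ → refl)))
             (mass-false π {P = E∩⋂R} (all-Zs (λ _ → refl))) ⟩
      x + (massY + 0ℚ)
        ≡⟨ cong (x +_) (+-identityʳ massY) ⟩
      x + massY ∎
      where
      open ≡-Reasoning
      E∩⋂R : World n k → Bool
      E∩⋂R ω = inE ω ∧ inCap R ω

    denominator : π* (inCap R) ≡ x + (x + (massY + massZ))
    denominator = begin
      π* (inCap R)
        ≡⟨ cong₂ (λ b c → (if b then x else 0ℚ) + ((if c then x else 0ℚ) + mass π (inCap R) (Ys ++ Zs)))
                 W0∈⋂R X0∈⋂R ⟩
      x + (x + mass π (inCap R) (Ys ++ Zs))
        ≡⟨ cong (λ q → x + (x + q)) (mass-++ π (inCap R) Ys Zs) ⟩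
      x + (x + (massY + massZ)) ∎
      where open ≡-Reasoning

    massY≤m*y : massY ≤ fromℕ m * y
    massY≤m*y = begin
      massY                  ≤⟨ mass-≤-length* π π-nonNeg (inCap R) (all-Ys (λ _ _ → ≤-refl)) ⟩
      fromℕ (length Ys) * y  ≡⟨ cong (λ a → fromℕ a * y) length-Ys ⟩
      fromℕ m * y            ∎
      where open ≤-Reasoning

    massY<massZ : 0 ℕ.< m → ∀ {ℓ} → inCap R (Z ℓ) ≡ true → massY < massZ
    massY<massZ 0<m {ℓ} Zℓ∈⋂R = begin-strict
      massY
        ≤⟨ massY≤m*y ⟩
      fromℕ m * y
        ≡⟨ +-identityʳ _ ⟨
      fromℕ m * y + 0ℚ
        <⟨ +-monoʳ-< (fromℕ m * y) (*-pos (fromℕ-pos 0<m) (y-pos 0<m)) ⟩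
      fromℕ m * y + fromℕ m * y
        ≡⟨ solve 2 (λ a y → con (fromℕ 2) :* a :* y := a :* y :+ a :* y) refl (fromℕ m) y ⟨
      z
        ≤⟨ member-≤-mass π π-nonNeg (inCap R) Zℓ∈Zs Zℓ∈⋂R ⟩
      massZ ∎
      where
      open ≤-Reasoning
      open +-*-Solver
      Zℓ∈Zs : Z ℓ List.∈ Zs
      Zℓ∈Zs = ∈-map⁺ Z (∈-allFin ℓ)

    condProb-<-½ : 0 ℕ.< m → ∀ {ℓ} → inCap R (Z ℓ) ≡ true → condProb R < ½
    condProb-<-½ 0<m Zℓ∈⋂R = begin-strict
      condProb R                                   ≡⟨ cong₂ _÷'_ numerator denominator ⟩
      (x + massY) ÷' (x + (x + (massY + massZ)))   <⟨ ÷'-<-½ 0<den twice-numerator<den ⟩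
      ½                                            ∎
      where
      open ≤-Reasoning
      open +-*-Solver
      0<den : 0ℚ < x + (x + (massY + massZ))
      0<den = +-mono-<-≤ (positive⁻¹ x) (+-mono-≤ (nonNegative⁻¹ x)
        (+-mono-≤ (mass-nonNeg π π-nonNeg (inCap R) Ys) (mass-nonNeg π π-nonNeg (inCap R) Zs)))
      twice-numerator<den : (x + massY) + (x + massY) < x + (x + (massY + massZ))
      twice-numerator<den = begin-strict
        (x + massY) + (x + massY)
          ≡⟨ solve 2 (λ x s → (x :+ s) :+ (x :+ s) := x :+ (x :+ (s :+ s))) refl x massY ⟩
        x + (x + (massY + massY))
          <⟨ +-monoʳ-< x (+-monoʳ-< x (+-monoʳ-< massY (massY<massZ 0<m Zℓ∈⋂R))) ⟩
        x + (x + (massY + massZ)) ∎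

mainTheorem3 : (n k : ℕ) (A : Fin k → Subset n) → IsExactCoverInstance n k A →
    (R : Subset k) → (∃ λ ℓ → Construction.inCap n k A R (Z ℓ) ≡ true) →
    Construction.condProb n k A R < Construction.τ n k A
mainTheorem3 n k A cover R (ℓ , Zℓ∈⋂R) =
  <-≤-trans (condProb-<-½ A R 0<m Zℓ∈⋂R) (½-≤-τ A n≤m)
  where
  open Construction n k A using (m)
  n≤m : n ℕ.≤ m
  n≤m = covering⇒n≤m A cover
  0<m : 0 ℕ.< m
  0<m = ℕ.<-≤-trans (ℕ.≤-<-trans z≤n (toℕ<n ℓ)) n≤m
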